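{- Let $(u,v)$ be a bridge with $\mathrm{t}(u,v)\le l_m$. Then: if $(u,v)$ is matched, then $u$ and $v$ are both inner vertices; if $(u,v)$ is unmatched, then $\mathrm{t}(u)\le\mathrm{t}(u,v)$ when $u$ is outer, and $\mathrm{t}(u)<\mathrm{t}(u,v)$ when $u$ is inner.
   Context: $G=(V,E)$ is a finite undirected graph and $M$ a matching; edges in $M$ are matched, others unmatched; a vertex is unmatched if no matched edge is incident to it. An alternating path is a simple path alternating between matched and unmatched edges; $l_m$ is the minimum length of an alternating path joining two distinct unmatched vertices ($\infty$ if none). $\mathrm{evenlevel}(v)$ ($\mathrm{oddlevel}(v)$) is the length of a minimum even (odd) length alternating path from some unmatched vertex to $v$ ($\infty$ if none). $\mathrm{minlevel}(v)$ is the smaller of these; a $\mathrm{minlevel}(v)$ path is an alternating path from an unmatched vertex to $v$ of that minimum length and parity. A vertex with finite minlevel is outer if $\mathrm{evenlevel}(v)<\mathrm{oddlevel}(v)$ and inner otherwise. Tenacity: $\mathrm{t}(v)=\mathrm{evenlevel}(v)+\mathrm{oddlevel}(v)$; an unmatched edge has $\mathrm{t}(u,v)=\mathrm{evenlevel}(u)+\mathrm{evenlevel}(v)+1$, a matched edge $\mathrm{t}(u,v)=\mathrm{oddlevel}(u)+\mathrm{oddlevel}(v)+1$. An edge that is the last edge of some $\mathrm{minlevel}(w)$ path (for some vertex $w$) is a prop; an edge that is not a prop is a bridge. -}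

module Defs where

open import Data.Nat using (ℕ; zero; suc; _+_; _≤_; _<_)
open import Data.Nat using (_%_)
open import Data.Bool using (Bool; true; false; not)
open import Data.Fin using (Fin)
open import Data.List using (List; []; _∷_; length)
open import Data.List.Relation.Unary.Linked using (Linked)
open import Data.List.Relation.Unary.Unique.Propositional using (Unique)
open import Data.Product using (Σ; _×_; ∃; _,_)
open import Data.Sum using (_⊎_)
open import Data.Unit using (⊤)
open import Relation.Nullary using (¬_)
open import Relation.Binary.PropositionalEquality using (_≡_; _≢_)

data ℕ∞ : Set where
  fin : ℕ → ℕ∞
  ∞   : ℕ∞

infixl 6 _+∞_
_+∞_ : ℕ∞ → ℕ∞ → ℕ∞
fin a +∞ fin b = fin (a + b)
fin _ +∞ ∞     = ∞
∞     +∞ _     = ∞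

min∞ : ℕ∞ → ℕ∞ → ℕ∞
min∞ (fin a) (fin b) = fin (Data.Nat._⊓_ a b)
min∞ (fin a) ∞       = fin a
min∞ ∞       y       = y

infix 4 _≤∞_ _<∞_
data _≤∞_ : ℕ∞ → ℕ∞ → Set where
  fin≤fin : ∀ {a b} → a ≤ b → fin a ≤∞ fin b
  _≤∞∞    : ∀ x → x ≤∞ ∞

data _<∞_ : ℕ∞ → ℕ∞ → Set where
  fin<fin : ∀ {a b} → a < b → fin a <∞ fin b
  fin<∞   : ∀ a → fin a <∞ ∞

Finite : ℕ∞ → Set
Finite x = Σ ℕ λ k → x ≡ fin k

IsMin : (ℕ → Set) → ℕ∞ → Set
IsMin P (fin k) = P k × (∀ j → P j → k ≤ j)
IsMin P ∞       = ∀ j → ¬ P j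

Even : ℕ → Set
Even k = k % 2 ≡ 0

Odd : ℕ → Set
Odd k = k % 2 ≡ 1

record Graph (n : ℕ) : Set where
  field
    adj    : Fin n → Fin n → Bool
    sym    : ∀ u v → adj u v ≡ adj v u
    irrefl : ∀ u → adj u u ≡ false

record Matching {n : ℕ} (G : Graph n) : Set where
  field
    mat    : Fin n → Fin n → Bool
    sub    : ∀ u v → mat u v ≡ true → Graph.adj G u v ≡ true
    sym    : ∀ u v → mat u v ≡ mat v u
    unique : ∀ u v w → mat u v ≡ true → mat u w ≡ true → v ≡ w

module _ {n : ℕ} (G : Graph n) (M : Matching G) where
  open Graph G
  open Matching M

  V : Set
  V = Fin n

  Edge : V → V → Set
  Edge u v = adj u v ≡ true

  MatchedEdge : V → V → Set
  MatchedEdge u v = mat u v ≡ true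

  UnmatchedVertex : V → Set
  UnmatchedVertex v = ∀ w → mat v w ≡ false

  Alternates : List V → Set
  Alternates (x ∷ y ∷ z ∷ r) = (mat x y ≡ not (mat y z)) × Alternates (y ∷ z ∷ r)
  Alternates _ = ⊤

  IsAltPath : V → List V → Set
  IsAltPath s xs = Unique (s ∷ xs) × Linked Edge (s ∷ xs) × Alternates (s ∷ xs)

  lastV : V → List V → V
  lastV s []       = s
  lastV s (x ∷ xs) = lastV x xs

  -- penultimate vertex (only meaningful when xs is nonempty)
  penultV : V → List V → V
  penultV s []           = s
  penultV s (x ∷ [])     = s
  penultV s (x ∷ y ∷ xs) = penultV x (y ∷ xs)

  AltPathFromFree : V → ℕ → Set
  AltPathFromFree v k =
    Σ V λ s → Σ (List V) λ xs →
      UnmatchedVertex s × IsAltPath s xs × lastV s xs ≡ v × length xs ≡ k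

  IsEvenLevel : (V → ℕ∞) → Set
  IsEvenLevel el = ∀ v → IsMin (λ k → Even k × AltPathFromFree v k) (el v)

  IsOddLevel : (V → ℕ∞) → Set
  IsOddLevel ol = ∀ v → IsMin (λ k → Odd k × AltPathFromFree v k) (ol v)

  IsLm : ℕ∞ → Set
  IsLm lm = IsMin (λ k → Σ V λ s → Σ (List V) λ xs →
                     UnmatchedVertex s × UnmatchedVertex (lastV s xs) ×
                     s ≢ lastV s xs × IsAltPath s xs × length xs ≡ k) lm

  module Levels (el ol : V → ℕ∞) where

    minlevel : V → ℕ∞
    minlevel v = min∞ (el v) (ol v)

    Outer : V → Set
    Outer v = Finite (minlevel v) × el v <∞ ol v

    Inner : V → Set
    Inner v = Finite (minlevel v) × ¬ (el v <∞ ol v)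

    t : V → ℕ∞
    t v = el v +∞ ol v

    tEdge : V → V → ℕ∞
    tEdge u v with mat u v
    ... | true  = ol u +∞ ol v +∞ fin 1
    ... | false = el u +∞ el v +∞ fin 1

    MinlevelPath : V → V → List V → Set
    MinlevelPath w s xs =
      UnmatchedVertex s × IsAltPath s xs × lastV s xs ≡ w × minlevel w ≡ fin (length xs)

    LastEdgeOfMinlevelPath : V → V → Set
    LastEdgeOfMinlevelPath x w =
      Σ V λ s → Σ (List V) λ xs →
        MinlevelPath w s xs × (xs ≢ []) × penultV s xs ≡ x

    PropEdge : V → V → Set
    PropEdge u v = Edge u v × (LastEdgeOfMinlevelPath u v ⊎ LastEdgeOfMinlevelPath v u)

    Bridge : V → V → Set
    Bridge u v = Edge u v × ¬ PropEdge u v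

-- If (u,v) is matched and u were outer, a shortest even alternating path to u would end with the
-- matched edge of u, namely (v,u), and would be a minlevel(u) path; so (v,u) would be a prop.
--
-- If (u,v) is unmatched, let P be a shortest even path to v, of length L. Both claims reduce to
-- oddlevel(u) ≤ L + 1, and oddlevel(u) ≤ L when u is inner. If u is not on P, then P followed by
-- (v,u) is an odd path of length L + 1, and it would be a minlevel(u) path if u were inner with
-- oddlevel(u) = L + 1. If u lies on P at an odd position, the prefix of P up to u suffices. If it
-- lies at an even position i, the segment C of P from u to v closes with (v,u) into an odd cycle.
-- The prefix of P followed by (u,v) shows oddlevel(v) ≤ i + 1, with equality excluded because
-- (u,v) is not a prop, so some odd path R to v is shorter than i. Let x be the first vertex of R
-- on C. If x ≠ u, the mate of x lies on C, so R reaches x with odd length, and continuing around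
-- the cycle from x along its matched edge gives an odd path to u of length at most L + 1. If x = u,
-- the prefix of R up to u is either odd, and is the required path, or even, and followed by C it
-- gives an even path to v shorter than L.

module Submission where

open import Defs
open import Data.Bool using (Bool; true; false; not; if_then_else_)
open import Data.Bool.Properties using (not-involutive)
open import Data.Empty using (⊥; ⊥-elim)
open import Data.Fin using (Fin)
import Data.Fin
open import Data.List using (List; []; _∷_; _++_; _∷ʳ_; length; reverse; reverseAcc; initLast; _∷ʳ′_)
open import Data.List.Properties
  using ( unfold-reverse; reverse-++; length-++; length-reverse; ∷ʳ-++; ++-assoc; ++-conicalʳ
        ; ∷ʳ-injective; ∷ʳ-injectiveˡ)
open import Data.List.Membership.Propositional using (_∈_; _∉_; lose)
open import Data.List.Membership.Propositional.Properties using (∈-++⁺ʳ; ∈-++⁺ˡ; ∈-++⁻; ∈-∃++)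
import Data.List.Membership.DecPropositional as DecMembership
open import Data.List.Relation.Unary.All as All using ([]; _∷_)
open import Data.List.Relation.Unary.All.Properties using (++⁻ˡ; ++⁻ʳ; All¬⇒¬Any)
open import Data.List.Relation.Unary.Any using (Any; here; there)
open import Data.List.Relation.Unary.Any.Properties using (reverse⁻)
open import Data.List.Relation.Unary.AllPairs using ([]; _∷_)
import Data.List.Relation.Unary.First as First
open import Data.List.Relation.Unary.First.Properties using (toView)
open import Data.List.Relation.Unary.Linked using (Linked; []; [-]; _∷_)
open import Data.List.Relation.Unary.Unique.Propositional using (Unique)
open import Data.List.Relation.Unary.Unique.Propositional.Properties using (++⁺; Unique[x∷xs]⇒x∉xs)
open import Data.List.Relation.Binary.Disjoint.Propositional using (Disjoint)
open import Data.Nat using (ℕ; zero; suc; _+_; _≤_; _<_; _%_; _⊓_; s≤s; z≤n)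
open import Data.Nat.DivMod using ([m+n]%n≡m%n)
open import Data.Nat.Properties
open import Data.Product using (Σ; _×_; _,_; proj₁; proj₂)
open import Data.Sum using (inj₁; inj₂; swap)
open import Data.Unit using (⊤; tt)
open import Function using (case_of_)
open import Relation.Binary.Definitions using (DecidableEquality)
open import Relation.Binary.PropositionalEquality
open import Relation.Nullary using (¬_; yes; no)
open import Relation.Nullary.Decidable using (toSum)

flips : ℕ → Bool → Bool
flips zero    b = b
flips (suc k) b = flips k (not b)

parity : ℕ → Bool
parity k = flips k false

flips-not : ∀ k b → flips k (not b) ≡ not (flips k b)
flips-not zero    b = refl
flips-not (suc k) b = flips-not k (not b)

flips-+ : ∀ m n b → flips (m + n) b ≡ flips n (flips m b)
flips-+ zero    n b = refl
flips-+ (suc m) n b = flips-+ m n (not b)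

parity-+ : ∀ m n → parity (m + n) ≡ flips n (parity m)
parity-+ m n = flips-+ m n false

parity-suc : ∀ k → parity (suc k) ≡ not (parity k)
parity-suc k = flips-not k false

parity-+-even : ∀ s j → parity (suc s) ≡ false → parity (suc (s + j)) ≡ parity j
parity-+-even s j s-even = trans (flips-+ s j true) (cong (flips j) s-even)

parity-%2 : ∀ k → k % 2 ≡ (if parity k then 1 else 0)
parity-%2 0             = refl
parity-%2 1             = refl
parity-%2 (suc (suc k)) = trans (cong (_% 2) (+-comm 2 k)) (trans ([m+n]%n≡m%n k 2) (parity-%2 k))

parity≡false⇒Even : ∀ k → parity k ≡ false → Even k
parity≡false⇒Even k eq = trans (parity-%2 k) (cong (if_then 1 else 0) eq)

parity≡true⇒Odd : ∀ k → parity k ≡ true → Odd k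
parity≡true⇒Odd k eq = trans (parity-%2 k) (cong (if_then 1 else 0) eq)

Even⇒parity≡false : ∀ k → Even k → parity k ≡ false
Even⇒parity≡false k even with parity k | parity-%2 k
... | false | _   = refl
... | true  | odd with () ← trans (sym even) odd

Odd⇒parity≡true : ∀ k → Odd k → parity k ≡ true
Odd⇒parity≡true k odd with parity k | parity-%2 k
... | true  | _    = refl
... | false | even with () ← trans (sym odd) even

≤∞-fin⁻ : ∀ {x k} → x ≤∞ fin k → Σ ℕ λ c → x ≡ fin c × c ≤ k
≤∞-fin⁻ (fin≤fin c≤k) = _ , refl , c≤k

fin≤∞fin⁻ : ∀ {a b} → fin a ≤∞ fin b → a ≤ b
fin≤∞fin⁻ (fin≤fin a≤b) = a≤b

≤∞-trans : ∀ {x y z} → x ≤∞ y → y ≤∞ z → x ≤∞ z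
≤∞-trans (fin≤fin a≤b) (fin≤fin b≤c) = fin≤fin (≤-trans a≤b b≤c)
≤∞-trans {x}           _             (_ ≤∞∞) = x ≤∞∞

<∞⇒≤∞ : ∀ {x y} → x <∞ y → x ≤∞ y
<∞⇒≤∞ (fin<fin a<b) = fin≤fin (<⇒≤ a<b)
<∞⇒≤∞ (fin<∞ a)     = fin a ≤∞∞

<∞-finiteˡ : ∀ {x y} → x <∞ y → Finite x
<∞-finiteˡ (fin<fin _) = _ , refl
<∞-finiteˡ (fin<∞ a)   = a , refl

≮∞⇒≥∞ : ∀ {x y} → ¬ (x <∞ y) → y ≤∞ x
≮∞⇒≥∞ {fin a} {fin b} b≮a = fin≤fin (≮⇒≥ (λ a<b → b≮a (fin<fin a<b)))
≮∞⇒≥∞ {fin a} {∞}     ∞≮a = ⊥-elim (∞≮a (fin<∞ a))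
≮∞⇒≥∞ {∞}     {y}     _   = y ≤∞∞

min∞-eqˡ : ∀ {x y} → x ≤∞ y → min∞ x y ≡ x
min∞-eqˡ (fin≤fin a≤b) = cong fin (m≤n⇒m⊓n≡m a≤b)
min∞-eqˡ (fin a ≤∞∞)   = refl
min∞-eqˡ (∞ ≤∞∞)       = refl

min∞-eqʳ : ∀ {x y} → y ≤∞ x → min∞ x y ≡ y
min∞-eqʳ (fin≤fin b≤a) = cong fin (m≥n⇒m⊓n≡n b≤a)
min∞-eqʳ {∞}     (y ≤∞∞) = refl

min∞-finiteʳ : ∀ x {y} → Finite y → Finite (min∞ x y)
min∞-finiteʳ (fin a) (b , refl) = a ⊓ b , refl
min∞-finiteʳ ∞       fin-y      = fin-y

+∞-finite⁻ : ∀ x y {z k} → x +∞ y +∞ z ≡ fin k → Finite x × Finite y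
+∞-finite⁻ (fin a) (fin b) _ = (a , refl) , (b , refl)

+∞-assoc : ∀ x y z → (x +∞ y) +∞ z ≡ x +∞ (y +∞ z)
+∞-assoc (fin a) (fin b) (fin c) = cong fin (+-assoc a b c)
+∞-assoc (fin a) (fin b) ∞       = refl
+∞-assoc (fin a) ∞       z       = refl
+∞-assoc ∞       y       z       = refl

+∞-monoʳ-≤∞ : ∀ x {y z} → y ≤∞ z → x +∞ y ≤∞ x +∞ z
+∞-monoʳ-≤∞ (fin a) (fin≤fin b≤c) = fin≤fin (+-monoʳ-≤ a b≤c)
+∞-monoʳ-≤∞ (fin a) (y ≤∞∞)       = (fin a +∞ y) ≤∞∞
+∞-monoʳ-≤∞ ∞       _             = ∞ ≤∞∞

+∞-monoʳ-<∞ : ∀ a {y z} → y <∞ z → fin a +∞ y <∞ fin a +∞ z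
+∞-monoʳ-<∞ a (fin<fin b<c) = fin<fin (+-monoʳ-< a b<c)
+∞-monoʳ-<∞ a (fin<∞ b)     = fin<∞ (a + b)

IsMin-fin : ∀ {P x c} → IsMin P x → x ≡ fin c → P c
IsMin-fin (pc , _) refl = pc

IsMin-≤ : ∀ {P x k} → IsMin P x → P k → x ≤∞ fin k
IsMin-≤ {x = fin c} (_ , least) pk = fin≤fin (least _ pk)
IsMin-≤ {x = ∞}     none        pk = ⊥-elim (none _ pk)

module _ {A : Set} where

  length-∷ʳ : ∀ (xs : List A) x → length (xs ∷ʳ x) ≡ suc (length xs)
  length-∷ʳ xs x = trans (length-++ xs) (+-comm (length xs) 1)

  Unique-++⁻ : ∀ (xs : List A) {ys} → Unique (xs ++ ys) → Unique xs × Unique ys × Disjoint xs ys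
  Unique-++⁻ []       u        = [] , u , λ ()
  Unique-++⁻ (x ∷ xs) (x∉ ∷ u) with Unique-++⁻ xs u
  ... | uxs , uys , disj = ++⁻ˡ xs x∉ ∷ uxs , uys , λ where
    (here refl , q) → All.lookup (++⁻ʳ xs x∉) q refl
    (there p   , q) → disj (p , q)

  Unique-reverse : ∀ {xs : List A} → Unique xs → Unique (reverse xs)
  Unique-reverse {[]}     []       = []
  Unique-reverse {x ∷ xs} (x∉ ∷ u) =
    subst Unique (sym (unfold-reverse x xs))
      (++⁺ (Unique-reverse u) ([] ∷ []) λ where (p , here refl) → All.lookup x∉ (reverse⁻ p) refl)

  Unique[xs∷ʳx]⇒x∉xs : ∀ {xs : List A} {x} → Unique (xs ∷ʳ x) → x ∉ xs
  Unique[xs∷ʳx]⇒x∉xs {xs} u x∈ = proj₂ (proj₂ (Unique-++⁻ xs u)) (x∈ , here refl)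

  reverse-∷-∷ʳ : ∀ (x : A) xs y → reverse (x ∷ xs ∷ʳ y) ≡ y ∷ reverse xs ∷ʳ x
  reverse-∷-∷ʳ x xs y = trans (unfold-reverse x (xs ∷ʳ y)) (cong (_∷ʳ x) (reverse-++ xs (y ∷ [])))

  ∷ʳ⊆++∷ : ∀ xs {x ys} {z : A} → z ∈ xs ∷ʳ x → z ∈ xs ++ x ∷ ys
  ∷ʳ⊆++∷ xs {x} {ys} z∈ = subst (_ ∈_) (∷ʳ-++ xs x ys) (∈-++⁺ˡ z∈)

  length-prefix-< : ∀ {xs ys : List A} {y zs} → xs ≡ ys ++ y ∷ zs → length ys < length xs
  length-prefix-< {ys = ys} refl = subst (length ys <_) (sym (length-++ ys)) (m<m+n (length ys) (s≤s z≤n))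

  module _ (_≟_ : DecidableEquality A) (C : List A) where

    split-at-first-∈ : ∀ {l} → Any (_∈ C) l →
      Σ (List A) λ xs → Σ A λ x → Σ (List A) λ ys → l ≡ xs ++ x ∷ ys × Disjoint xs C × x ∈ C
    split-at-first-∈ {l} any with First.first (λ x → swap (toSum (DecMembership._∈?_ _≟_ x C))) l
    ... | inj₂ all∉ = ⊥-elim (All¬⇒¬Any all∉ any)
    ... | inj₁ f with toView f
    ... | First._++_∷_ ps q ys = _ , _ , ys , refl , (λ (p , r) → All.lookup ps p r) , q

module Paths {n : ℕ} (G : Graph n) (M : Matching G) where
  open Matching M using (mat)
  open DecMembership (Data.Fin._≟_ {n}) using (_∈?_)

  initV : Fin n → List (Fin n) → List (Fin n)
  initV s []       = []
  initV s (x ∷ xs) = s ∷ initV x xs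

  ∷≡initV∷ʳlastV : ∀ s xs → s ∷ xs ≡ initV s xs ∷ʳ lastV G M s xs
  ∷≡initV∷ʳlastV s []       = refl
  ∷≡initV∷ʳlastV s (x ∷ xs) = cong (s ∷_) (∷≡initV∷ʳlastV x xs)

  length-initV : ∀ s xs → length (initV s xs) ≡ length xs
  length-initV s []       = refl
  length-initV s (x ∷ xs) = cong suc (length-initV x xs)

  lastV-∷ʳ : ∀ s X {w} → lastV G M s (X ∷ʳ w) ≡ w
  lastV-∷ʳ s []      = refl
  lastV-∷ʳ s (x ∷ X) = lastV-∷ʳ x X

  penultV-∷ʳ : ∀ s Y {y w} → penultV G M s (Y ∷ʳ y ∷ʳ w) ≡ y
  penultV-∷ʳ s []          = refl
  penultV-∷ʳ s (x ∷ [])    = refl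
  penultV-∷ʳ s (x ∷ z ∷ Y) = penultV-∷ʳ x (z ∷ Y)

  AltWalk : Bool → List (Fin n) → Set
  AltWalk b (x ∷ y ∷ l) = Edge G M x y × mat x y ≡ b × AltWalk (not b) (y ∷ l)
  AltWalk b _           = ⊤

  AltWalk-++⁻ : ∀ X {a Y b} → AltWalk b (X ++ a ∷ Y) →
                AltWalk b (X ∷ʳ a) × AltWalk (flips (length X) b) (a ∷ Y)
  AltWalk-++⁻ []          w           = tt , w
  AltWalk-++⁻ (x ∷ [])    (e , m , w) = (e , m , tt) , w
  AltWalk-++⁻ (x ∷ y ∷ X) (e , m , w) with AltWalk-++⁻ (y ∷ X) w
  ... | w₁ , w₂ = (e , m , w₁) , w₂

  AltWalk-++⁺ : ∀ X {a Y b} → AltWalk b (X ∷ʳ a) → AltWalk (flips (length X) b) (a ∷ Y) →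
                AltWalk b (X ++ a ∷ Y)
  AltWalk-++⁺ []          _            w₂ = w₂
  AltWalk-++⁺ (x ∷ [])    (e , m , _)  w₂ = e , m , w₂
  AltWalk-++⁺ (x ∷ y ∷ X) (e , m , w₁) w₂ = e , m , AltWalk-++⁺ (y ∷ X) w₁ w₂

  AltWalk-reverseAcc : ∀ l {x acc b} → AltWalk b (x ∷ l) → AltWalk (not b) (x ∷ acc) →
                       AltWalk (not (flips (length l) b)) (reverseAcc (x ∷ acc) l)
  AltWalk-reverseAcc []      _           w = w
  AltWalk-reverseAcc (y ∷ l) {x} {acc} {b} (e , m , w) w′ =
    AltWalk-reverseAcc l w
      ( trans (Graph.sym G y x) e
      , trans (Matching.sym M y x) (trans m (sym (not-involutive b)))
      , subst (λ c → AltWalk (not c) (x ∷ acc)) (sym (not-involutive b)) w′)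

  AltWalk-reverse : ∀ {x l b} → AltWalk b (x ∷ l) → AltWalk (not (flips (length l) b)) (reverse (x ∷ l))
  AltWalk-reverse {l = l} w = AltWalk-reverseAcc l w tt

  AltPath : Bool → List (Fin n) → Set
  AltPath b l = Unique l × AltWalk b l

  AltPath-++⁻ : ∀ X {a Y b} → AltPath b (X ++ a ∷ Y) →
                AltPath b (X ∷ʳ a) × AltPath (flips (length X) b) (a ∷ Y) × Disjoint X (a ∷ Y)
  AltPath-++⁻ X {a} {Y} (u , w) =
    let uX∷ʳa , _ , _      = Unique-++⁻ (X ∷ʳ a) (subst Unique (sym (∷ʳ-++ X a Y)) u)
        _ , ua∷Y , disjoint = Unique-++⁻ X u
        w₁ , w₂             = AltWalk-++⁻ X w
    in (uX∷ʳa , w₁) , (ua∷Y , w₂) , disjoint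

  AltPath-++⁺ : ∀ X {a Y b} → AltPath b (X ∷ʳ a) → AltPath (flips (length X) b) (a ∷ Y) →
                Disjoint X (a ∷ Y) → AltPath b (X ++ a ∷ Y)
  AltPath-++⁺ X (u₁ , w₁) (u₂ , w₂) disjoint =
    ++⁺ (proj₁ (Unique-++⁻ X u₁)) u₂ disjoint , AltWalk-++⁺ X w₁ w₂

  Edge⇒≢ : ∀ {x y} → Edge G M x y → x ≢ y
  Edge⇒≢ {x} e refl with () ← trans (sym e) (Graph.irrefl G x)

  AltPath-edge : ∀ {b x y} → Edge G M x y → mat x y ≡ b → AltPath b (x ∷ y ∷ [])
  AltPath-edge e m = ((Edge⇒≢ e ∷ []) ∷ [] ∷ []) , e , m , tt

  AltPath-reverse : ∀ {x l b} → AltPath b (x ∷ l) → AltPath (not (flips (length l) b)) (reverse (x ∷ l))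
  AltPath-reverse (u , w) = Unique-reverse u , AltWalk-reverse w

  StartsUnmatched : List (Fin n) → Set
  StartsUnmatched []      = ⊥
  StartsUnmatched (s ∷ _) = UnmatchedVertex G M s

  StartsUnmatched-++ : ∀ X {a Y Y′} → StartsUnmatched (X ++ a ∷ Y) → StartsUnmatched (X ++ a ∷ Y′)
  StartsUnmatched-++ []      s = s
  StartsUnmatched-++ (_ ∷ _) s = s

  -- An alternating path of length k from an unmatched vertex to w, with vertex list before ∷ʳ w;
  -- its i-th edge is matched iff i is odd.
  record FreePath (w : Fin n) (k : ℕ) : Set where
    constructor freePath
    field
      before           : List (Fin n)
      length-before    : length before ≡ k
      starts-unmatched : StartsUnmatched (before ∷ʳ w)
      alternating      : AltPath false (before ∷ʳ w)

  open FreePath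

  prefix : ∀ {w k A a B} (p : FreePath w k) → before p ∷ʳ w ≡ A ++ a ∷ B → FreePath a (length A)
  prefix {A = A} (freePath _ _ s ap) eq =
    freePath A refl (StartsUnmatched-++ A (subst StartsUnmatched eq s))
                    (proj₁ (AltPath-++⁻ A (subst (AltPath false) eq ap)))

  suffix : ∀ {w k A a B} (p : FreePath w k) → before p ∷ʳ w ≡ A ++ a ∷ B →
           AltPath (parity (length A)) (a ∷ B) × Disjoint A (a ∷ B)
  suffix {A = A} (freePath _ _ _ ap) eq = proj₂ (AltPath-++⁻ A (subst (AltPath false) eq ap))

  splice : ∀ {x j S w} (p : FreePath x j) → AltPath (parity j) (x ∷ S ∷ʳ w) →
           Disjoint (before p) (x ∷ S ∷ʳ w) → FreePath w (suc (length S + j))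
  splice {x} {j} {S} {w} p segment disjoint =
    freePath (before p ++ x ∷ S) length-joined
      (subst StartsUnmatched (sym reassoc) (StartsUnmatched-++ (before p) (starts-unmatched p)))
      (subst (AltPath false) (sym reassoc) (AltPath-++⁺ (before p) (alternating p) segment′ disjoint))
    where
    reassoc : (before p ++ x ∷ S) ∷ʳ w ≡ before p ++ x ∷ S ∷ʳ w
    reassoc = ++-assoc (before p) (x ∷ S) (w ∷ [])
    segment′ : AltPath (parity (length (before p))) (x ∷ S ∷ʳ w)
    segment′ = subst (λ k → AltPath (parity k) _) (sym (length-before p)) segment
    length-joined : length (before p ++ x ∷ S) ≡ suc (length S + j)
    length-joined = begin
      length (before p ++ x ∷ S)          ≡⟨ length-++ (before p) ⟩
      length (before p) + suc (length S)  ≡⟨ +-suc (length (before p)) (length S) ⟩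
      suc (length (before p) + length S)  ≡⟨ cong suc (+-comm (length (before p)) (length S)) ⟩
      suc (length S + length (before p))  ≡⟨ cong (λ k → suc (length S + k)) (length-before p) ⟩
      suc (length S + j)                  ∎
      where open ≡-Reasoning

  last-edge : ∀ {w k} (p : FreePath w (suc k)) →
              Σ (List (Fin n)) λ Y → Σ (Fin n) λ y → before p ≡ Y ∷ʳ y × mat y w ≡ parity k
  last-edge {w} (freePath (x ∷ X) len _ ap) =
    Y , y , split , subst (λ i → mat y w ≡ parity i) length-Y (proj₁ (proj₂ last-step))
    where
    Y = initV x X
    y = lastV G M x X
    split : x ∷ X ≡ Y ∷ʳ y
    split = ∷≡initV∷ʳlastV x X
    last-step : AltWalk (parity (length Y)) (y ∷ w ∷ [])
    last-step = proj₂ (proj₁ (proj₂ (AltPath-++⁻ Y (subst (AltPath false) vertices ap))))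
      where
      vertices : (x ∷ X) ∷ʳ w ≡ Y ++ y ∷ w ∷ []
      vertices = trans (cong (_∷ʳ w) split) (∷ʳ-++ Y y (w ∷ []))
    length-Y : length Y ≡ _
    length-Y = suc-injective (trans (sym (length-∷ʳ Y y)) (trans (cong length (sym split)) len))

  AltWalk⇒Linked : ∀ {b l} → AltWalk b l → Linked (Edge G M) l
  AltWalk⇒Linked {l = []}        _           = []
  AltWalk⇒Linked {l = _ ∷ []}    _           = [-]
  AltWalk⇒Linked {l = _ ∷ _ ∷ _} (e , _ , w) = e ∷ AltWalk⇒Linked w

  AltWalk⇒Alternates : ∀ {b l} → AltWalk b l → Alternates G M l
  AltWalk⇒Alternates {l = []}            _ = tt
  AltWalk⇒Alternates {l = _ ∷ []}        _ = tt
  AltWalk⇒Alternates {l = _ ∷ _ ∷ []}    _ = tt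
  AltWalk⇒Alternates {b} {_ ∷ _ ∷ _ ∷ _} (_ , m , w@(_ , m′ , _)) =
    trans m (trans (sym (not-involutive b)) (cong not (sym m′))) , AltWalk⇒Alternates w

  Alternates⇒AltWalk : ∀ {x y l} → Linked (Edge G M) (x ∷ y ∷ l) → Alternates G M (x ∷ y ∷ l) →
                       AltWalk (mat x y) (x ∷ y ∷ l)
  Alternates⇒AltWalk {l = []}            (e ∷ _)  _            = e , refl , tt
  Alternates⇒AltWalk {x} {y} {z ∷ l} (e ∷ lk) (alt , alts) =
    e , refl , subst (λ b → AltWalk b (y ∷ z ∷ l)) mat-y-z (Alternates⇒AltWalk lk alts)
    where
    mat-y-z : mat y z ≡ not (mat x y)
    mat-y-z = trans (sym (not-involutive (mat y z))) (cong not (sym alt))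

  AltPath⇒IsAltPath : ∀ {b s xs} → AltPath b (s ∷ xs) → IsAltPath G M s xs
  AltPath⇒IsAltPath (u , w) = u , AltWalk⇒Linked w , AltWalk⇒Alternates w

  IsAltPath⇒AltPath : ∀ {s xs} → UnmatchedVertex G M s → IsAltPath G M s xs → AltPath false (s ∷ xs)
  IsAltPath⇒AltPath {xs = []}    _  (u , _ , _)    = u , tt
  IsAltPath⇒AltPath {s} {y ∷ xs} un (u , lk , alt) =
    u , subst (λ b → AltWalk b (s ∷ y ∷ xs)) (un y) (Alternates⇒AltWalk lk alt)

  FreePath⇒AltPathFromFree : ∀ {w k} → FreePath w k → AltPathFromFree G M w k
  FreePath⇒AltPathFromFree {w} (freePath []      refl s ap) =
    w , [] , s , AltPath⇒IsAltPath {false} ap , refl , refl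
  FreePath⇒AltPathFromFree {w} (freePath (x ∷ X) refl s ap) =
    x , X ∷ʳ w , s , AltPath⇒IsAltPath {false} ap , lastV-∷ʳ x X , length-∷ʳ X w

  AltPathFromFree⇒FreePath : ∀ {w k} → AltPathFromFree G M w k → FreePath w k
  AltPathFromFree⇒FreePath (s , xs , un , path , refl , refl) =
    freePath (initV s xs) (length-initV s xs)
      (subst StartsUnmatched split un) (subst (AltPath false) split (IsAltPath⇒AltPath un path))
    where
    split = ∷≡initV∷ʳlastV s xs

  even-path-ends-at-mate : ∀ {x j y} (p : FreePath x j) → parity j ≡ false → mat x y ≡ true →
                           Σ (List (Fin n)) λ Y → before p ≡ Y ∷ʳ y
  even-path-ends-at-mate (freePath [] refl s _) _ matched with () ← trans (sym matched) (s _)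
  even-path-ends-at-mate {x} {y = y} p@(freePath (_ ∷ X) refl _ _) even matched
    with Y , y′ , split , matched′ ← last-edge p =
    Y , subst (λ z → _ ≡ Y ∷ʳ z) (Matching.unique M x y′ y mate-y′ matched) split
    where
    mate-y′ : mat x y′ ≡ true
    mate-y′ = trans (Matching.sym M x y′) (trans matched′ X-odd)
      where
      X-odd : parity (length X) ≡ true
      X-odd = trans (sym (not-involutive _)) (cong not (trans (sym (parity-suc (length X))) even))

  mate-off-path⇒odd : ∀ {x j y} (p : FreePath x j) → mat x y ≡ true → y ∉ before p → parity j ≡ true
  mate-off-path⇒odd {j = j} p matched y∉ with parity j in j-parity
  ... | true  = refl
  ... | false with Y , split ← even-path-ends-at-mate p j-parity matched =
    ⊥-elim (y∉ (subst (_ ∈_) (sym split) (∈-++⁺ʳ Y (here refl))))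

  AltWalk-first : ∀ {b x} S {w} → AltWalk b (x ∷ S ∷ʳ w) → Σ (Fin n) λ y → y ∈ S ∷ʳ w × mat x y ≡ b
  AltWalk-first []      {w} (_ , matched , _) = w , here refl , matched
  AltWalk-first (s ∷ _)     (_ , matched , _) = s , here refl , matched

  detour : ∀ {x j S w} (p : FreePath x j) → AltPath true (x ∷ S ∷ʳ w) →
           Disjoint (before p) (x ∷ S ∷ʳ w) → parity (suc (length S)) ≡ false →
           parity (suc (length S + j)) ≡ true × FreePath w (suc (length S + j))
  detour {j = j} {S} p segment disjoint S-even with y , y∈ , matched ← AltWalk-first S (proj₂ segment) =
    trans (parity-+-even (length S) j S-even) j-odd ,
    splice p (subst (λ b → AltPath b _) (sym j-odd) segment) disjoint
    where
    j-odd : parity j ≡ true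
    j-odd = mate-off-path⇒odd p matched (λ y∈p → disjoint (y∈p , there y∈))

  module LevelPaths (el ol : Fin n → ℕ∞) (hel : IsEvenLevel G M el) (hol : IsOddLevel G M ol) where
    open Levels G M el ol

    evenlevel-path : ∀ {w c} → el w ≡ fin c → parity c ≡ false × FreePath w c
    evenlevel-path {w} {c} eq with even , p ← IsMin-fin (hel w) eq =
      Even⇒parity≡false c even , AltPathFromFree⇒FreePath p

    oddlevel-path : ∀ {w c} → ol w ≡ fin c → parity c ≡ true × FreePath w c
    oddlevel-path {w} {c} eq with odd , p ← IsMin-fin (hol w) eq =
      Odd⇒parity≡true c odd , AltPathFromFree⇒FreePath p

    evenlevel-≤ : ∀ {w k} → parity k ≡ false → FreePath w k → el w ≤∞ fin k
    evenlevel-≤ {w} {k} even p = IsMin-≤ (hel w) (parity≡false⇒Even k even , FreePath⇒AltPathFromFree p)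

    oddlevel-≤ : ∀ {w k} → parity k ≡ true → FreePath w k → ol w ≤∞ fin k
    oddlevel-≤ {w} {k} odd p = IsMin-≤ (hol w) (parity≡true⇒Odd k odd , FreePath⇒AltPathFromFree p)

    evenlevel-fin-≤ : ∀ {w c k} → el w ≡ fin c → parity k ≡ false → FreePath w k → c ≤ k
    evenlevel-fin-≤ el≡ even p = fin≤∞fin⁻ (subst (_≤∞ _) el≡ (evenlevel-≤ even p))

    oddlevel-fin-≤ : ∀ {w c k} → ol w ≡ fin c → parity k ≡ true → FreePath w k → c ≤ k
    oddlevel-fin-≤ ol≡ odd p = fin≤∞fin⁻ (subst (_≤∞ _) ol≡ (oddlevel-≤ odd p))

    minlevel-last-edge : ∀ {w k Y y} (p : FreePath w k) → before p ≡ Y ∷ʳ y → minlevel w ≡ fin k →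
                         LastEdgeOfMinlevelPath y w
    minlevel-last-edge {Y = []}    (freePath _ refl s ap) refl min≡ =
      _ , _ , (s , AltPath⇒IsAltPath {false} ap , refl , min≡) , (λ ()) , refl
    minlevel-last-edge {w} {Y = x ∷ Y} {y} (freePath _ refl s ap) refl min≡ =
      x , Y ∷ʳ y ∷ʳ w ,
      (s , AltPath⇒IsAltPath {false} ap , lastV-∷ʳ x (Y ∷ʳ y) ,
       trans min≡ (cong fin (sym (length-∷ʳ (Y ∷ʳ y) w)))) ,
      (λ eq → case ++-conicalʳ (Y ∷ʳ y) (w ∷ []) eq of λ ()) ,
      penultV-∷ʳ x Y

    matched-end-inner : ∀ {a b} → mat a b ≡ true → Finite (ol a) → ¬ LastEdgeOfMinlevelPath b a → Inner a
    matched-end-inner {a} matched ol-finite not-last = min∞-finiteʳ (el a) ol-finite , not-outer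
      where
      not-outer : ¬ (el a <∞ ol a)
      not-outer el<ol
        with c , el≡ ← <∞-finiteˡ el<ol
        with even , p ← evenlevel-path el≡
        with Y , split ← even-path-ends-at-mate p even matched =
        not-last (minlevel-last-edge p split (trans (min∞-eqˡ (<∞⇒≤∞ el<ol)) el≡))

    tEdge-matched : ∀ {a b} → mat a b ≡ true → tEdge a b ≡ ol a +∞ ol b +∞ fin 1
    tEdge-matched {a} {b} matched rewrite matched = refl

    tEdge-unmatched : ∀ {a b} → mat a b ≡ false → tEdge a b ≡ el a +∞ el b +∞ fin 1
    tEdge-unmatched {a} {b} unmatched rewrite unmatched = refl

    module UnmatchedBridge {u v} (edge : Edge G M u v) (not-prop : ¬ PropEdge u v) (unmatched : mat u v ≡ false)
                           {L} (el-v : el v ≡ fin L) where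

      L-even : parity L ≡ false
      L-even = proj₁ (evenlevel-path el-v)

      P : FreePath v L
      P = proj₂ (evenlevel-path el-v)

      1+L-odd : parity (suc L) ≡ true
      1+L-odd = trans (parity-suc L) (cong not L-even)

      edge-vu : Edge G M v u
      edge-vu = trans (Graph.sym G v u) edge

      unmatched-vu : mat v u ≡ false
      unmatched-vu = trans (Matching.sym M v u) unmatched

      ShortOddPath : Set
      ShortOddPath = Σ ℕ λ m → parity m ≡ true × FreePath u m × m ≤ suc L

      extension : u ∉ before P → FreePath u (suc L)
      extension u∉ =
        splice {S = []} P (AltPath-edge edge-vu (trans unmatched-vu (sym L-even))) λ where
          (p , here refl)         → Unique[xs∷ʳx]⇒x∉xs (proj₁ (alternating P)) p
          (p , there (here refl)) → u∉ p

      module OnPath {A B} (split : before P ≡ A ++ u ∷ B) where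

        C : List (Fin n)
        C = u ∷ B ∷ʳ v

        vertices-split : before P ∷ʳ v ≡ A ++ C
        vertices-split = trans (cong (_∷ʳ v) split) (++-assoc A (u ∷ B) (v ∷ []))

        length-split : length A + suc (length B) ≡ L
        length-split = trans (sym (length-++ A)) (trans (cong length (sym split)) (length-before P))

        L≡ : suc (length B + length A) ≡ L
        L≡ = trans (cong suc (+-comm (length B) (length A)))
               (trans (sym (+-suc (length A) (length B))) length-split)

        A<L : length A < L
        A<L = subst (length A <_) L≡ (s≤s (m≤n+m (length A) (length B)))

        within-L : ∀ {s j} → s ≤ length B → j < length A → suc (s + j) < L
        within-L {s} {j} s≤B j<A =
          subst (_< L) (+-suc s j) (subst (suc (s + suc j) ≤_) L≡ (s≤s (+-mono-≤ s≤B j<A)))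

        path-to-u : FreePath u (length A)
        path-to-u = prefix P vertices-split

        C-path : AltPath (parity (length A)) C
        C-path = proj₁ (suffix P vertices-split)

        A-disjoint-C : Disjoint A C
        A-disjoint-C = proj₂ (suffix P vertices-split)

        v∈C : v ∈ C
        v∈C = there (∈-++⁺ʳ B (here refl))

        module Blossom (A-even : parity (length A) ≡ false) where

          1+A-odd : parity (suc (length A)) ≡ true
          1+A-odd = trans (parity-suc (length A)) (cong not A-even)

          C-even : parity (suc (length B)) ≡ false
          C-even = trans (cong (λ b → flips (length B) (not b)) (sym A-even))
                     (trans (sym (parity-+ (length A) (suc (length B)))) (trans (cong parity length-split) L-even))

          to-v-via-u : FreePath v (suc (length A))
          to-v-via-u = splice {S = []} path-to-u (AltPath-edge edge (trans unmatched (sym A-even))) λ where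
                (p , here refl)         → A-disjoint-C (p , here refl)
                (p , there (here refl)) → A-disjoint-C (p , v∈C)

          odd-path-to-v : Σ ℕ λ ov → parity ov ≡ true × FreePath v ov × ov < length A
          odd-path-to-v
            with ov , ol≡ , ov≤ ← ≤∞-fin⁻ (oddlevel-≤ 1+A-odd to-v-via-u)
            with ov-odd , R ← oddlevel-path ol≡ =
            ov , ov-odd , R , ≤∧≢⇒< (m<1+n⇒m≤n (≤∧≢⇒< ov≤ ov≢1+A)) ov≢A
            where
            ov≢A : ov ≢ length A
            ov≢A refl with () ← trans (sym ov-odd) A-even
            ov≢1+A : ov ≢ suc (length A)
            ov≢1+A refl =
              not-prop (edge , inj₁ (minlevel-last-edge to-v-via-u refl (trans (min∞-eqʳ ol≤el) ol≡)))
              where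
              ol≤el : ol v ≤∞ el v
              ol≤el = subst₂ _≤∞_ (sym ol≡) (sym el-v) (fin≤fin A<L)

          via-detour : ∀ {x j S} (r : FreePath x j) → AltPath true (x ∷ S ∷ʳ u) →
                       (∀ {z} → z ∈ x ∷ S ∷ʳ u → z ∈ C) → Disjoint (before r) C →
                       parity (suc (length S)) ≡ false → length S ≤ length B → j < length A → ShortOddPath
          via-detour r segment segment⊆C disjoint S-even S≤B j<A
            with odd , p ← detour r segment (λ (q , z∈) → disjoint (q , segment⊆C z∈)) S-even =
            _ , odd , p , m<n⇒m≤1+n (within-L S≤B j<A)

          entry-at-u : ∀ {j} (r : FreePath u j) → Disjoint (before r) C → j < length A → ShortOddPath
          entry-at-u {j} r disjoint j<A with parity j in j-parity
          ... | true  = j , j-parity , r , <⇒≤ (<-trans j<A (m<n⇒m<1+n A<L))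
          ... | false = ⊥-elim (<⇒≱ (within-L ≤-refl j<A) (evenlevel-fin-≤ el-v even to-v))
            where
            to-v : FreePath v (suc (length B + j))
            to-v = splice r (subst (λ b → AltPath b C) (trans A-even (sym j-parity)) C-path) disjoint
            even : parity (suc (length B + j)) ≡ false
            even = trans (parity-+-even (length B) j C-even) j-parity

          -- The mate of x precedes it on P: walk back along P to u.
          backward : ∀ {x j B₁ B₂} (r : FreePath x j) → Disjoint (before r) C →
                     B ∷ʳ v ≡ B₁ ++ x ∷ B₂ → parity (suc (length B₁)) ≡ false → j < length A →
                     ShortOddPath
          backward {x} {j} {B₁} {B₂} r disjoint B-split x-even j<A =
            via-detour r segment segment⊆C disjoint S-even S≤B j<A
            where
            C-split : C ≡ u ∷ B₁ ++ x ∷ B₂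
            C-split = cong (u ∷_) B-split
            u-to-x : AltPath (parity (length A)) (u ∷ B₁ ∷ʳ x)
            u-to-x = proj₁ (AltPath-++⁻ (u ∷ B₁) (subst (AltPath _) C-split C-path))
            bit : not (flips (length (B₁ ∷ʳ x)) (parity (length A))) ≡ true
            bit = cong not (trans (cong (λ k → flips k (parity (length A))) (length-∷ʳ B₁ x))
                                  (trans (cong (λ b → flips (length B₁) (not b)) A-even) x-even))
            segment : AltPath true (x ∷ reverse B₁ ∷ʳ u)
            segment = subst₂ AltPath bit (reverse-∷-∷ʳ u B₁ x) (AltPath-reverse u-to-x)
            segment⊆C : ∀ {z} → z ∈ x ∷ reverse B₁ ∷ʳ u → z ∈ C
            segment⊆C {z} z∈ = subst (z ∈_) (sym C-split)
              (∷ʳ⊆++∷ (u ∷ B₁) (reverse⁻ (subst (z ∈_) (sym (reverse-∷-∷ʳ u B₁ x)) z∈)))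
            S-even : parity (suc (length (reverse B₁))) ≡ false
            S-even = trans (cong (λ k → parity (suc k)) (length-reverse B₁)) x-even
            S≤B : length (reverse B₁) ≤ length B
            S≤B = subst (_≤ length B) (sym (length-reverse B₁))
                    (m<1+n⇒m≤n (subst (length B₁ <_) (length-∷ʳ B v) (length-prefix-< B-split)))

          -- The mate of x follows it on P: walk on along P to v, then take (v,u).
          forward : ∀ {x j B₁ D} (r : FreePath x j) → Disjoint (before r) C → B ≡ B₁ ++ x ∷ D →
                    parity (suc (length B₁)) ≡ true → j < length A → ShortOddPath
          forward {x} {j} {B₁} {D} r disjoint B≡ x-odd j<A =
            via-detour r segment segment⊆C disjoint S-even S≤B j<A
            where
            C-split : C ≡ u ∷ B₁ ++ x ∷ D ∷ʳ v
            C-split = cong (u ∷_) (trans (cong (_∷ʳ v) B≡) (++-assoc B₁ (x ∷ D) (v ∷ [])))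
            length-B : length B ≡ length B₁ + suc (length D)
            length-B = trans (cong length B≡) (length-++ B₁)
            x-to-v : AltPath true (x ∷ D ∷ʳ v)
            x-to-v = subst (λ b → AltPath b _) (trans (cong (λ b → flips (length B₁) (not b)) A-even) x-odd)
                       (proj₁ (proj₂ (AltPath-++⁻ (u ∷ B₁) (subst (AltPath _) C-split C-path))))
            D-even : parity (length D) ≡ false
            D-even = trans (cong (flips (suc (length D))) (sym x-odd))
                       (trans (sym (flips-+ (length B₁) (suc (length D)) true))
                         (trans (cong (λ k → flips k true) (sym length-B)) C-even))
            u∉x∷D : u ∉ x ∷ D
            u∉x∷D u∈ =
              Unique[x∷xs]⇒x∉xs (proj₁ C-path) (∈-++⁺ˡ (subst (u ∈_) (sym B≡) (∈-++⁺ʳ B₁ u∈)))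
            v-to-u : AltPath (flips (length (x ∷ D)) true) (v ∷ u ∷ [])
            v-to-u = AltPath-edge edge-vu (trans unmatched-vu (sym D-even))
            segment : AltPath true (x ∷ D ∷ʳ v ∷ʳ u)
            segment = subst (AltPath true) (cong (x ∷_) (sym (∷ʳ-++ D v (u ∷ []))))
                        (AltPath-++⁺ (x ∷ D) x-to-v v-to-u λ where
                          (q , here refl)         → Unique[xs∷ʳx]⇒x∉xs (proj₁ x-to-v) q
                          (q , there (here refl)) → u∉x∷D q)
            segment⊆C : ∀ {z} → z ∈ x ∷ D ∷ʳ v ∷ʳ u → z ∈ C
            segment⊆C {z} z∈ with ∈-++⁻ (x ∷ D ∷ʳ v) z∈
            ... | inj₁ q         = subst (z ∈_) (sym C-split) (there (∈-++⁺ʳ B₁ q))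
            ... | inj₂ (here refl) = here refl
            S-even : parity (suc (length (D ∷ʳ v))) ≡ false
            S-even = trans (cong (λ k → parity (suc k)) (length-∷ʳ D v)) D-even
            S≤B : length (D ∷ʳ v) ≤ length B
            S≤B = subst₂ _≤_ (sym (length-∷ʳ D v)) (sym length-B) (m≤n+m (suc (length D)) (length B₁))

          entry-after-u : ∀ {x j B₁ B₂} (r : FreePath x j) → Disjoint (before r) C →
                          B ∷ʳ v ≡ B₁ ++ x ∷ B₂ → j < length A → ShortOddPath
          entry-after-u {x} {j} {B₁} {B₂} r disjoint B-split j<A with parity (suc (length B₁)) in x-parity
          ... | false = backward r disjoint B-split x-parity j<A
          ... | true with initLast B₂
          ...   | [] with () ← trans (sym x-parity)
                                 (trans (cong (λ Z → parity (suc (length Z))) (sym (∷ʳ-injectiveˡ B B₁ B-split)))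
                                        C-even)
          ...   | D ∷ʳ′ y
            with B≡ , refl ← ∷ʳ-injective B (B₁ ++ x ∷ D) (trans B-split (sym (++-assoc B₁ (x ∷ D) (y ∷ [])))) =
            forward r disjoint B≡ x-parity j<A

          odd-path-to-u : ShortOddPath
          odd-path-to-u
            with ov , _ , R , ov<A ← odd-path-to-v
            with A′ , x , _ , R-split , A′-disjoint , x∈C
                   ← split-at-first-∈ Data.Fin._≟_ C (lose (∈-++⁺ʳ (before R) (here refl)) v∈C) =
            enter x∈C (prefix R R-split) A′-disjoint (≤-<-trans A′≤ov ov<A)
            where
            A′≤ov : length A′ ≤ ov
            A′≤ov = m<1+n⇒m≤n (subst (length A′ <_) length-R (length-prefix-< R-split))
              where
              length-R : length (before R ∷ʳ v) ≡ suc ov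
              length-R = trans (length-∷ʳ (before R) v) (cong suc (length-before R))
            enter : ∀ {x j} → x ∈ C → (r : FreePath x j) → Disjoint (before r) C → j < length A → ShortOddPath
            enter (here refl) r disjoint j<A = entry-at-u r disjoint j<A
            enter (there x∈)  r disjoint j<A with B₁ , B₂ , B-split ← ∈-∃++ x∈ =
              entry-after-u r disjoint B-split j<A

      odd-path-to-u : ShortOddPath
      odd-path-to-u with u ∈? before P
      ... | no u∉  = suc L , 1+L-odd , extension u∉ , ≤-refl
      ... | yes u∈ with A , B , split ← ∈-∃++ u∈ with parity (length A) in A-parity
      ...   | true  = length A , A-parity , OnPath.path-to-u split , <⇒≤ (m<n⇒m<1+n (OnPath.A<L split))
      ...   | false = OnPath.Blossom.odd-path-to-u split A-parity

      el-v+1 : el v +∞ fin 1 ≡ fin (suc L)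
      el-v+1 = trans (cong (_+∞ fin 1) el-v) (cong fin (+-comm L 1))

      oddlevel-bound : ol u ≤∞ el v +∞ fin 1
      oddlevel-bound with m , odd , p , m≤ ← odd-path-to-u =
        subst (ol u ≤∞_) (sym el-v+1) (≤∞-trans (oddlevel-≤ odd p) (fin≤fin m≤))

      inner-oddlevel-bound : ∀ {eu ou} → el u ≡ fin eu → ol u ≡ fin ou → ou ≤ eu → ou ≤ L
      inner-oddlevel-bound el-u ol-u ou≤eu with u ∈? before P
      ... | no u∉ = m<1+n⇒m≤n (≤∧≢⇒< ou≤1+L ou≢1+L)
        where
        ou≤1+L : _ ≤ suc L
        ou≤1+L = oddlevel-fin-≤ ol-u 1+L-odd (extension u∉)
        ou≢1+L : _ ≢ suc L
        ou≢1+L refl =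
          not-prop (edge , inj₂ (minlevel-last-edge (extension u∉) refl (trans (min∞-eqʳ ol≤el) ol-u)))
          where
          ol≤el : ol u ≤∞ el u
          ol≤el = subst₂ _≤∞_ (sym ol-u) (sym el-u) (fin≤fin ou≤eu)
      ... | yes u∈ with A , B , split ← ∈-∃++ u∈ with parity (length A) in A-parity
      ...   | false = ≤-trans ou≤eu (≤-trans (evenlevel-fin-≤ el-u A-parity path-to-u) (<⇒≤ A<L))
        where open OnPath split
      ...   | true  = ≤-trans (oddlevel-fin-≤ ol-u A-parity path-to-u) (<⇒≤ A<L)
        where open OnPath split

      tEdge≡ : tEdge u v ≡ el u +∞ (el v +∞ fin 1)
      tEdge≡ = trans (tEdge-unmatched unmatched) (+∞-assoc (el u) (el v) (fin 1))

      outer-tenacity : t u ≤∞ tEdge u v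
      outer-tenacity = subst (t u ≤∞_) (sym tEdge≡) (+∞-monoʳ-≤∞ (el u) oddlevel-bound)

      inner-tenacity : ∀ {eu} → el u ≡ fin eu → Inner u → t u <∞ tEdge u v
      inner-tenacity {eu} el-u (_ , not-outer)
        with ou , ol-u , ou≤eu ← ≤∞-fin⁻ (subst (ol u ≤∞_) el-u (≮∞⇒≥∞ not-outer)) =
        subst₂ _<∞_ (cong (_+∞ ol u) (sym el-u)) (trans (cong (_+∞ (el v +∞ fin 1)) (sym el-u)) (sym tEdge≡))
          (+∞-monoʳ-<∞ eu ol<el-v+1)
        where
        ol<el-v+1 : ol u <∞ el v +∞ fin 1
        ol<el-v+1 = subst₂ _<∞_ (sym ol-u) (sym el-v+1) (fin<fin (s≤s (inner-oddlevel-bound el-u ol-u ou≤eu)))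

lemma8p1 : ∀ {n} (G : Graph n) (M : Matching G) (el ol : Fin n → ℕ∞) (lm : ℕ∞) →
    IsEvenLevel G M el → IsOddLevel G M ol → IsLm G M lm →
    let open Levels G M el ol in
    ∀ u v → Bridge u v →
    (Σ ℕ λ k → tEdge u v ≡ fin k × fin k ≤∞ lm) →
    (Matching.mat M u v ≡ true → Inner u × Inner v) ×
    (Matching.mat M u v ≡ false →
      (Outer u → t u ≤∞ tEdge u v) × (Inner u → t u <∞ tEdge u v))
-- Only the finiteness of t(u,v) is used.
lemma8p1 G M el ol _ hel hol _ u v (edge , not-prop) (_ , tEdge-finite , _) = matched-case , unmatched-case
  where
  open Paths G M
  open LevelPaths el ol hel hol
  open Levels G M el ol

  matched-case : Matching.mat M u v ≡ true → Inner u × Inner v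
  matched-case matched
    with ol-u , ol-v ← +∞-finite⁻ (ol u) (ol v) (trans (sym (tEdge-matched matched)) tEdge-finite) =
    matched-end-inner matched ol-u (λ last → not-prop (edge , inj₂ last)) ,
    matched-end-inner (trans (Matching.sym M v u) matched) ol-v (λ last → not-prop (edge , inj₁ last))

  unmatched-case : Matching.mat M u v ≡ false → (Outer u → t u ≤∞ tEdge u v) × (Inner u → t u <∞ tEdge u v)
  unmatched-case unmatched
    with (_ , el-u) , (_ , el-v) ← +∞-finite⁻ (el u) (el v) (trans (sym (tEdge-unmatched unmatched)) tEdge-finite) =
    (λ _ → outer-tenacity) , inner-tenacity el-u
    where
    open UnmatchedBridge edge not-prop unmatched el-v
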